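{- Let $G_0=(V_0,E_0)$ be a $\phi$-expander with $m$ edges, $n$ vertices and minimum degree $\delta$. For $S\subseteq V_0$ let $\mathsf{vol}_0(S)$ be its volume in $G_0$. Consider a sequence of adversarial edge deletions, where at step $t\ge1$ an edge $e_t\in E_{t-1}$ of the current graph $G_{t-1}=(V_{t-1},E_{t-1})$ is deleted, and the procedure \textsc{Prune} produces $G_t$ as follows: set $E_t\leftarrow E_{t-1}\setminus\{e_t\}$, $V_t\leftarrow V_{t-1}$; while there is a subset $A\subseteq V_t$, taken to be the smaller side of the cut, with $|E_t(A,V_t\setminus A)|<(\phi/6)\cdot\mathsf{vol}_0(A)$, remove $A$ (set $V_t\leftarrow V_t\setminus A$ and $E_t\leftarrow$ the edges of $E_t$ with both endpoints in the new $V_t$). Let $P_t=V_0\setminus V_t$ be the set of vertices pruned during the first $t$ deletions. Then for each $1\le t\le \phi^2m/20$: (i) $P_t\subseteq P_{t+1}$; (ii) for every $A\subseteq V_t$, $|E_t(A,V_t\setminus A)|\ge(\phi/6)\min(\mathsf{vol}_0(A),\mathsf{vol}_0(V_t\setminus A))$, and hence every vertex of $V_t$ has degree at least $\phi\delta/6$ in $G_t$; (iii) $\mathsf{vol}_0(P_t)\le 6t/(5\phi)$.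
   Context: For an undirected graph and $S\subseteq V$, $\mathsf{vol}(S)=\sum_{v\in S}\deg(v)$, and $E(S,T)$ denotes the set of edges with one endpoint in $S$ and one in $T$. A graph $G=(V,E)$ is a $\phi$-expander if $|E(S,V\setminus S)|\ge\phi\min(\mathsf{vol}(S),\mathsf{vol}(V\setminus S))$ for all $S\subseteq V$. Here $\mathsf{vol}_0$ always refers to degrees in the initial graph $G_0$.
   Formalization: The expansion parameter φ, and with it the pruning threshold φ/6, ranges over the positive rationals. -}

module Defs where

open import Data.Nat as ℕ using (ℕ; zero; suc)
open import Data.Fin using (Fin; toℕ; _≟_)
open import Data.Bool using (Bool; true; false; _∧_; not; if_then_else_)
open import Data.Vec using (lookup)
open import Data.Fin.Subset using (Subset; _∈_; _⊆_; ⊤; ∁; _─_)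
open import Data.Integer using (+_)
open import Data.Rational using (ℚ; _/_; _*_; _⊓_; _<_; _≤_; 0ℚ)
open import Data.Product using (Σ; _×_; ∃)
open import Relation.Binary.PropositionalEquality using (_≡_)
open import Relation.Nullary using (¬_; does)

sumFin : ∀ {n} → (Fin n → ℕ) → ℕ
sumFin {zero}  f = 0
sumFin {suc n} f = f Fin.zero ℕ.+ sumFin (λ i → f (Fin.suc i))

[_] : Bool → ℕ
[ true ]  = 1
[ false ] = 0

toℚ : ℕ → ℚ
toℚ k = + k / 1

-- Edge sets on the vertex type Fin n, given by adjacency (an edge {u,v}
-- is present iff E u v ≡ true).
EdgeSet : ℕ → Set
EdgeSet n = Fin n → Fin n → Bool

IsSimple : ∀ {n} → EdgeSet n → Set
IsSimple E = (∀ u v → E u v ≡ E v u) × (∀ u → E u u ≡ false)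

deg : ∀ {n} → EdgeSet n → Fin n → ℕ
deg E u = sumFin (λ v → [ E u v ])

-- Number of edges (unordered pairs {u,v}, counted once via toℕ u < toℕ v).
numEdges : ∀ {n} → EdgeSet n → ℕ
numEdges E = sumFin (λ u → sumFin (λ v → [ does (toℕ u ℕ.<? toℕ v) ∧ E u v ]))

IsMinDegree : ∀ {n} → EdgeSet n → ℕ → Set
IsMinDegree E δ = (∀ v → δ ℕ.≤ deg E v) × ∃ (λ v → deg E v ≡ δ)

vol : ∀ {n} → EdgeSet n → Subset n → ℕ
vol E S = sumFin (λ v → if lookup S v then deg E v else 0)

-- |E(S,T)|: number of edges of E with one endpoint in S and one in T
-- (S and T will always be disjoint, so ordered pairs count each edge once).
cut : ∀ {n} → EdgeSet n → Subset n → Subset n → ℕ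
cut E S T = sumFin (λ u → sumFin (λ v → [ lookup S u ∧ lookup T v ∧ E u v ]))

IsExpander : ∀ {n} → ℚ → EdgeSet n → Set
IsExpander {n} φ E = ∀ (S : Subset n) →
  φ * (toℚ (vol E S) ⊓ toℚ (vol E (∁ S))) ≤ toℚ (cut E S (∁ S))

-- The Prune process.  A state is a pair (V, E) of a vertex set and an
-- edge set; E only contains edges with both endpoints in V.

record State (n : ℕ) : Set where
  constructor ⟨_,_⟩
  field
    verts : Subset n
    edges : EdgeSet n
open State public

deleteEdge : ∀ {n} → Fin n → Fin n → EdgeSet n → EdgeSet n
deleteEdge a b E u v =
  if (does (u ≟ a) ∧ does (v ≟ b)) Data.Bool.∨ (does (u ≟ b) ∧ does (v ≟ a))
  then false else E u v

restrict : ∀ {n} → Subset n → EdgeSet n → EdgeSet n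
restrict W E u v = lookup W u ∧ lookup W v ∧ E u v

Violating : ∀ {n} → ℚ → EdgeSet n → State n → Subset n → Set
Violating φ E₀ G A =
  A ⊆ verts G ×
  vol E₀ A ℕ.≤ vol E₀ (verts G ─ A) ×
  toℚ (cut (edges G) A (verts G ─ A)) < (φ * (+ 1 / 6)) * toℚ (vol E₀ A)

removeSet : ∀ {n} → Subset n → State n → State n
removeSet A G = ⟨ verts G ─ A , restrict (verts G ─ A) (edges G) ⟩

data PruneLoop {n : ℕ} (φ : ℚ) (E₀ : EdgeSet n) : State n → State n → Set where
  done : ∀ {G} → (∀ A → ¬ Violating φ E₀ G A) → PruneLoop φ E₀ G G
  step : ∀ {G G'} A → Violating φ E₀ G A →
         PruneLoop φ E₀ (removeSet A G) G' → PruneLoop φ E₀ G G'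

Update : ∀ {n} → ℚ → EdgeSet n → State n → State n → Set
Update {n} φ E₀ G G' =
  Σ (Fin n) λ a → Σ (Fin n) λ b →
    edges G a b ≡ true ×
    PruneLoop φ E₀ ⟨ verts G , deleteEdge a b (edges G) ⟩ G'

IsRun : ∀ {n} → ℚ → EdgeSet n → ℕ → (ℕ → State n) → Set
IsRun φ E₀ T G =
  G 0 ≡ ⟨ ⊤ , E₀ ⟩ ×
  (∀ t → t ℕ.< T → Update φ E₀ (G t) (G (suc t)))

pruned : ∀ {n} → State n → Subset n
pruned G = ⊤ ─ verts G

{-# OPTIONS --safe #-}
module Submission where

-- Let P be the pruned vertices, V the remaining ones and E the current edges. The potential
-- |E₀(P, V)| + |E₀[V] ∖ E| grows by at most one per deleted edge, and by at most
-- |E(A, V ∖ A)| < (φ/6)·vol₀(A) when Prune removes a set A; so after t deletions it is at most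
-- t + (φ/6)·vol₀(P). As long as vol₀(P) ≤ vol₀(V), expansion of G₀ across (P, V) then gives
-- φ·vol₀(P) ≤ |E₀(P, V)| ≤ t + (φ/6)·vol₀(P), which is (iii). The pruned side does stay the lighter
-- one: if removing A made it heavier, expansion across (A, V₀ ∖ A) together with (iii) would force
-- vol₀(P ∪ A) ≥ m, which t ≤ φ²m/20 forbids. Part (ii) is the exit condition of the loop, and
-- applied to a single vertex it gives the degree bound.

open import Defs

module Counting where

  open import Data.Bool using (Bool; true; false; _∧_; _∨_; not; if_then_else_; T)
  open import Data.Bool.Properties using (∧-comm; ∨-comm; ∧-zeroʳ; ∧-identityʳ; T-∧)
  open import Data.Empty using (⊥-elim)
  open import Data.Fin using (Fin; zero; suc; toℕ; _≟_)
  import Data.Fin.Properties as Finₚ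
  open import Data.Fin.Subset using (Subset; _∈_; _⊆_; ⊤; ⊥; ∁; _─_; ⁅_⁆)
  open import Data.Fin.Subset.Properties using (drop-∷-⊆; ∈⊤; p─q⊆p; ⊆-trans)
  open import Data.Nat using (ℕ; zero; suc; _+_; _≤_; _<_; z≤n; s≤s; _≤ᵇ_; _<ᵇ_; _<?_)
  open import Data.Nat.Properties hiding (_≟_)
  open import Algebra.Properties.CommutativeMonoid.Sum +-0-commutativeMonoid
    using (sum; sum-cong-≗; sum-replicate-zero; ∑-distrib-+; ∑-comm)
  open import Data.Product using (∃; _,_; proj₁; proj₂)
  open import Data.Sum using (_⊎_; inj₁; inj₂)
  open import Data.Vec using ([]; _∷_; lookup; here)
  open import Data.Vec.Properties using (lookup-map; lookup-replicate; []=⇒lookup; lookup⇒[]=)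
  open import Function using (_∘_; Equivalence)
  open import Relation.Binary.PropositionalEquality hiding ([_])
  open import Relation.Nullary using (¬_; does; yes; no)
  open import Relation.Nullary.Decidable using (dec-true; dec-false)

  sumFin≡sum : ∀ {n} (f : Fin n → ℕ) → sumFin f ≡ sum f
  sumFin≡sum {zero}  f = refl
  sumFin≡sum {suc n} f = cong (f zero +_) (sumFin≡sum (f ∘ suc))

  sumFin-cong : ∀ {n} {f g : Fin n → ℕ} → (∀ i → f i ≡ g i) → sumFin f ≡ sumFin g
  sumFin-cong {f = f} {g} f≗g = trans (sumFin≡sum f) (trans (sum-cong-≗ f≗g) (sym (sumFin≡sum g)))

  sumFin-zero : ∀ n → sumFin {n} (λ _ → 0) ≡ 0
  sumFin-zero n = trans (sumFin≡sum {n} (λ _ → 0)) (sum-replicate-zero n)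

  sumFin-distrib-+ : ∀ {n} (f g : Fin n → ℕ) → sumFin (λ i → f i + g i) ≡ sumFin f + sumFin g
  sumFin-distrib-+ {n} f g = begin
    sumFin (λ i → f i + g i) ≡⟨ sumFin≡sum (λ i → f i + g i) ⟩
    sum (λ i → f i + g i)    ≡⟨ ∑-distrib-+ f g ⟩
    sum f + sum g            ≡⟨ sym (cong₂ _+_ (sumFin≡sum f) (sumFin≡sum g)) ⟩
    sumFin f + sumFin g      ∎
    where open ≡-Reasoning

  sumPairs : ∀ {n} → (Fin n → Fin n → ℕ) → ℕ
  sumPairs f = sumFin (λ u → sumFin (f u))

  sumPairs-transpose : ∀ {n} (f : Fin n → Fin n → ℕ) → sumPairs f ≡ sumPairs (λ u v → f v u)
  sumPairs-transpose f = begin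
    sumFin (λ i → sumFin (f i))            ≡⟨ sumFin-cong (λ i → sumFin≡sum (f i)) ⟩
    sumFin (λ i → sum (f i))               ≡⟨ sumFin≡sum (λ i → sum (f i)) ⟩
    sum (λ i → sum (f i))                  ≡⟨ ∑-comm f ⟩
    sum (λ j → sum (λ i → f i j))          ≡⟨ sumFin≡sum (λ j → sum (λ i → f i j)) ⟨
    sumFin (λ j → sum (λ i → f i j))       ≡⟨ sumFin-cong (λ j → sumFin≡sum (λ i → f i j)) ⟨
    sumFin (λ j → sumFin (λ i → f i j))    ∎
    where open ≡-Reasoning

  sumFin-mono : ∀ {n} {f g : Fin n → ℕ} → (∀ i → f i ≤ g i) → sumFin f ≤ sumFin g
  sumFin-mono {zero}  f≤g = z≤n
  sumFin-mono {suc n} f≤g = +-mono-≤ (f≤g zero) (sumFin-mono (f≤g ∘ suc))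

  term≤sumFin : ∀ {n} (f : Fin n → ℕ) i → f i ≤ sumFin f
  term≤sumFin f zero    = m≤m+n _ _
  term≤sumFin f (suc i) = ≤-trans (term≤sumFin (f ∘ suc) i) (m≤n+m _ (f zero))

  sumFin-supported : ∀ {n} (f : Fin n → ℕ) i → (∀ j → j ≢ i → f j ≡ 0) → sumFin f ≡ f i
  sumFin-supported {suc n} f zero f≡0 = begin
    f zero + sumFin (f ∘ suc) ≡⟨ cong (f zero +_) (sumFin-cong (λ j → f≡0 (suc j) λ ())) ⟩
    f zero + sumFin {n} (λ _ → 0) ≡⟨ cong (f zero +_) (sumFin-zero n) ⟩
    f zero + 0                ≡⟨ +-identityʳ _ ⟩
    f zero                    ∎
    where open ≡-Reasoning
  sumFin-supported {suc n} f (suc i) f≡0 =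
    cong₂ _+_ (f≡0 zero λ ())
      (sumFin-supported (f ∘ suc) i (λ j j≢i → f≡0 (suc j) (j≢i ∘ Finₚ.suc-injective)))

  sumFin-positive : ∀ {n} (f : Fin n → ℕ) → 0 < sumFin f → ∃ λ i → 0 < f i
  sumFin-positive {suc n} f 0<Σ with f zero in eq
  ... | suc _ = zero , subst (0 <_) (sym eq) (s≤s z≤n)
  ... | zero  with sumFin-positive (f ∘ suc) 0<Σ
  ...   | i , 0<fi = suc i , 0<fi

  sumFin-zero⊎≥ : ∀ {n} δ (f : Fin n → ℕ) → (∀ i → f i ≡ 0 ⊎ δ ≤ f i) →
    sumFin f ≡ 0 ⊎ δ ≤ sumFin f
  sumFin-zero⊎≥ {zero}  δ f h = inj₁ refl
  sumFin-zero⊎≥ {suc n} δ f h with h zero | sumFin-zero⊎≥ δ (f ∘ suc) (h ∘ suc)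
  ... | inj₂ δ≤f₀ | _          = inj₂ (≤-trans δ≤f₀ (m≤m+n _ _))
  ... | inj₁ _    | inj₂ δ≤Σ   = inj₂ (≤-trans δ≤Σ (m≤n+m _ (f zero)))
  ... | inj₁ f₀≡0 | inj₁ Σ≡0   = inj₁ (cong₂ _+_ f₀≡0 Σ≡0)

  sumPairs-cong : ∀ {n} {f g : Fin n → Fin n → ℕ} → (∀ u v → f u v ≡ g u v) → sumPairs f ≡ sumPairs g
  sumPairs-cong f≗g = sumFin-cong (λ u → sumFin-cong (f≗g u))

  sumPairs-mono : ∀ {n} {f g : Fin n → Fin n → ℕ} → (∀ u v → f u v ≤ g u v) → sumPairs f ≤ sumPairs g
  sumPairs-mono f≤g = sumFin-mono (λ u → sumFin-mono (f≤g u))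

  sumPairs-distrib-+ : ∀ {n} (f g : Fin n → Fin n → ℕ) →
    sumPairs (λ u v → f u v + g u v) ≡ sumPairs f + sumPairs g
  sumPairs-distrib-+ f g =
    trans (sumFin-cong (λ u → sumFin-distrib-+ (f u) (g u))) (sumFin-distrib-+ (sumFin ∘ f) (sumFin ∘ g))

  BoolFormula : ℕ → Set
  BoolFormula zero    = Bool
  BoolFormula (suc k) = Bool → BoolFormula k

  Tautology : ∀ k → BoolFormula k → Set
  Tautology zero    b = T b
  Tautology (suc k) F = ∀ b → Tautology k (F b)

  tautology? : ∀ k → BoolFormula k → Bool
  tautology? zero    b = b
  tautology? (suc k) F = tautology? k (F true) ∧ tautology? k (F false)

  tautology?-sound : ∀ k F → T (tautology? k F) → Tautology k F
  tautology?-sound zero    b h = h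
  tautology?-sound (suc k) F h true  = tautology?-sound k (F true)  (proj₁ (Equivalence.to T-∧ h))
  tautology?-sound (suc k) F h false = tautology?-sound k (F false) (proj₂ (Equivalence.to T-∧ h))

  lookup-⊤ : ∀ {n} (i : Fin n) → lookup ⊤ i ≡ true
  lookup-⊤ i = lookup-replicate i true

  lookup-∁ : ∀ {n} (p : Subset n) i → lookup (∁ p) i ≡ not (lookup p i)
  lookup-∁ p i = lookup-map i not p

  lookup-─ : ∀ {n} (p q : Subset n) i → lookup (p ─ q) i ≡ lookup p i ∧ not (lookup q i)
  lookup-─ (x ∷ p) (true  ∷ q) zero    = sym (∧-zeroʳ x)
  lookup-─ (x ∷ p) (false ∷ q) zero    = sym (∧-identityʳ x)
  lookup-─ (_ ∷ p) (_     ∷ q) (suc i) = lookup-─ p q i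

  lookup-⁅⁆ : ∀ {n} (i j : Fin n) → lookup ⁅ i ⁆ j ≡ does (j ≟ i)
  lookup-⁅⁆ zero    zero    = refl
  lookup-⁅⁆ zero    (suc j) = lookup-replicate j false
  lookup-⁅⁆ (suc i) zero    = refl
  lookup-⁅⁆ (suc i) (suc j) with j ≟ i | lookup-⁅⁆ i j
  ... | yes _ | eq = eq
  ... | no  _ | eq = eq

  ⊆⇒lookup-absorb : ∀ {n} {A V : Subset n} → A ⊆ V → ∀ u → lookup A u ≡ lookup A u ∧ lookup V u
  ⊆⇒lookup-absorb {A = A} {V} A⊆V u with lookup A u in eq
  ... | false = refl
  ... | true  = sym ([]=⇒lookup (A⊆V (lookup⇒[]= u A eq)))

  ∁≡⊤─ : ∀ {n} (p : Subset n) → ∁ p ≡ ⊤ ─ p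
  ∁≡⊤─ []          = refl
  ∁≡⊤─ (true  ∷ p) = cong (false ∷_) (∁≡⊤─ p)
  ∁≡⊤─ (false ∷ p) = cong (true ∷_) (∁≡⊤─ p)

  ∁-⊤─ : ∀ {n} (p : Subset n) → ∁ (⊤ ─ p) ≡ p
  ∁-⊤─ []          = refl
  ∁-⊤─ (true  ∷ p) = cong (true ∷_) (∁-⊤─ p)
  ∁-⊤─ (false ∷ p) = cong (false ∷_) (∁-⊤─ p)

  ─-─ : ∀ {n} {V A : Subset n} → A ⊆ V → V ─ (V ─ A) ≡ A
  ─-─ {V = []}        {[]}        _    = refl
  ─-─ {V = true  ∷ V} {true  ∷ A} A⊆V = cong (true ∷_) (─-─ (drop-∷-⊆ A⊆V))
  ─-─ {V = true  ∷ V} {false ∷ A} A⊆V = cong (false ∷_) (─-─ (drop-∷-⊆ A⊆V))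
  ─-─ {V = false ∷ V} {false ∷ A} A⊆V = cong (false ∷_) (─-─ (drop-∷-⊆ A⊆V))
  ─-─ {V = false ∷ V} {true  ∷ A} A⊆V with A⊆V here
  ... | ()

  ─-antimonoʳ : ∀ {n} (p : Subset n) {V W} → W ⊆ V → p ─ V ⊆ p ─ W
  ─-antimonoʳ p {V} {W} W⊆V {x} x∈p─V = lookup⇒[]= x (p ─ W) (begin
    lookup (p ─ W) x               ≡⟨ lookup-─ p W x ⟩
    lookup p x ∧ not (lookup W x)  ≡⟨ cong (λ w → lookup p x ∧ not w) (⊆⇒lookup-absorb W⊆V x) ⟩
    lookup p x ∧ not (lookup W x ∧ lookup V x)  ≡⟨ shrink (lookup p x) (lookup W x) _ p∖V ⟩
    true                           ∎)
    where
    open ≡-Reasoning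
    p∖V : lookup p x ∧ not (lookup V x) ≡ true
    p∖V = trans (sym (lookup-─ p V x)) ([]=⇒lookup x∈p─V)
    shrink : ∀ a w v → a ∧ not v ≡ true → a ∧ not (w ∧ v) ≡ true
    shrink true true  false _ = refl
    shrink true false false _ = refl

  Undirected : ∀ {n} → EdgeSet n → Set
  Undirected E = ∀ u v → E u v ≡ E v u

  deleteEdge-undirected : ∀ {n} {E : EdgeSet n} a b → Undirected E → Undirected (deleteEdge a b E)
  deleteEdge-undirected {E = E} a b E-undirected u v = cong₂ (λ c e → if c then false else e)
    (trans (∨-comm (does (u ≟ a) ∧ does (v ≟ b)) _)
           (cong₂ _∨_ (∧-comm (does (u ≟ b)) _) (∧-comm (does (u ≟ a)) _)))
    (E-undirected u v)

  ∧-swap : ∀ a b c → a ∧ (b ∧ c) ≡ b ∧ (a ∧ c)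
  ∧-swap true  b c = refl
  ∧-swap false b c = sym (∧-zeroʳ b)

  restrict-undirected : ∀ {n} {E : EdgeSet n} W → Undirected E → Undirected (restrict W E)
  restrict-undirected {E = E} W E-undirected u v =
    trans (cong (λ e → lookup W u ∧ lookup W v ∧ e) (E-undirected u v))
          (∧-swap (lookup W u) (lookup W v) (E v u))

  cut-sym : ∀ {n} {E : EdgeSet n} → Undirected E → ∀ S T → cut E S T ≡ cut E T S
  cut-sym {E = E} E-undirected S T =
    trans (sumPairs-transpose (λ u v → [ lookup S u ∧ lookup T v ∧ E u v ]))
          (sumPairs-cong λ u v → cong [_] (begin
      lookup S v ∧ lookup T u ∧ E v u  ≡⟨ ∧-swap (lookup S v) (lookup T u) (E v u) ⟩
      lookup T u ∧ lookup S v ∧ E v u  ≡⟨ cong (λ e → lookup T u ∧ lookup S v ∧ e) (E-undirected v u) ⟩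
      lookup T u ∧ lookup S v ∧ E u v  ∎))
    where open ≡-Reasoning

  cut≤vol : ∀ {n} (E : EdgeSet n) S T → cut E S T ≤ vol E S
  cut≤vol {n} E S T = sumFin-mono row≤
    where
    row≤ : ∀ u → sumFin (λ v → [ lookup S u ∧ lookup T v ∧ E u v ]) ≤ (if lookup S u then deg E u else 0)
    row≤ u with lookup S u
    ... | true  = sumFin-mono λ v → [∧]≤ (lookup T v) (E u v)
      where
      [∧]≤ : ∀ a b → [ a ∧ b ] ≤ [ b ]
      [∧]≤ true  b = ≤-refl
      [∧]≤ false b = z≤n
    ... | false = ≤-reflexive (sumFin-zero n)

  vol-split : ∀ {n} (E : EdgeSet n) {V A} → A ⊆ V → vol E V ≡ vol E A + vol E (V ─ A)
  vol-split E {V} {A} A⊆V =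
    trans (sumFin-cong split) (sumFin-distrib-+ (λ u → if lookup A u then deg E u else 0) _)
    where
    split₁ : ∀ v a d → (if v then d else 0) ≡ (if a ∧ v then d else 0) + (if v ∧ not (a ∧ v) then d else 0)
    split₁ true  true  d = sym (+-identityʳ d)
    split₁ true  false d = refl
    split₁ false a     d rewrite ∧-zeroʳ a = refl
    split : ∀ u → (if lookup V u then deg E u else 0) ≡
      (if lookup A u then deg E u else 0) + (if lookup (V ─ A) u then deg E u else 0)
    split u rewrite lookup-─ V A u | ⊆⇒lookup-absorb A⊆V u = split₁ (lookup V u) (lookup A u) (deg E u)

  vol-⊤ : ∀ {n} (E : EdgeSet n) V → vol E ⊤ ≡ vol E V + vol E (⊤ ─ V)
  vol-⊤ E V = vol-split E (λ _ → ∈⊤)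

  vol-⊥ : ∀ {n} (E : EdgeSet n) → vol E ⊥ ≡ 0
  vol-⊥ {n} E =
    trans (sumFin-cong λ u → cong (λ b → if b then deg E u else 0) (lookup-replicate u false)) (sumFin-zero n)

  vol-∁ : ∀ {n} (E : EdgeSet n) {V A} → A ⊆ V → vol E (∁ A) ≡ vol E (⊤ ─ V) + vol E (V ─ A)
  vol-∁ E {V} {A} A⊆V = +-cancelˡ-≡ (vol E A) _ _ (begin
    vol E A + vol E (∁ A)                    ≡⟨ cong (λ S → vol E A + vol E S) (∁≡⊤─ A) ⟩
    vol E A + vol E (⊤ ─ A)                  ≡⟨ vol-⊤ E A ⟨
    vol E ⊤                                  ≡⟨ vol-⊤ E V ⟩
    vol E V + vol E (⊤ ─ V)                  ≡⟨ cong (_+ vol E (⊤ ─ V)) (vol-split E A⊆V) ⟩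
    vol E A + vol E (V ─ A) + vol E (⊤ ─ V)  ≡⟨ +-assoc (vol E A) _ _ ⟩
    vol E A + (vol E (V ─ A) + vol E (⊤ ─ V)) ≡⟨ cong (vol E A +_) (+-comm (vol E (V ─ A)) _) ⟩
    vol E A + (vol E (⊤ ─ V) + vol E (V ─ A)) ∎)
    where open ≡-Reasoning

  vol-pruned-removeSet : ∀ {n} (E : EdgeSet n) {V A} → A ⊆ V →
    vol E (⊤ ─ (V ─ A)) ≡ vol E (⊤ ─ V) + vol E A
  vol-pruned-removeSet E {V} {A} A⊆V = +-cancelˡ-≡ (vol E (V ─ A)) _ _ (begin
    vol E (V ─ A) + vol E (⊤ ─ (V ─ A))      ≡⟨ vol-⊤ E (V ─ A) ⟨
    vol E ⊤                                  ≡⟨ vol-⊤ E V ⟩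
    vol E V + vol E (⊤ ─ V)                  ≡⟨ cong (_+ vol E (⊤ ─ V)) (vol-split E A⊆V) ⟩
    vol E A + vol E (V ─ A) + vol E (⊤ ─ V)  ≡⟨ cong (_+ vol E (⊤ ─ V)) (+-comm (vol E A) _) ⟩
    vol E (V ─ A) + vol E A + vol E (⊤ ─ V)  ≡⟨ +-assoc (vol E (V ─ A)) _ _ ⟩
    vol E (V ─ A) + (vol E A + vol E (⊤ ─ V)) ≡⟨ cong (vol E (V ─ A) +_) (+-comm (vol E A) _) ⟩
    vol E (V ─ A) + (vol E (⊤ ─ V) + vol E A) ∎)
    where open ≡-Reasoning

  vol-⁅⁆ : ∀ {n} (E : EdgeSet n) v → vol E ⁅ v ⁆ ≡ deg E v
  vol-⁅⁆ E v = trans (sumFin-supported _ v outside) (cong (λ b → if b then deg E v else 0) inside)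
    where
    inside : lookup ⁅ v ⁆ v ≡ true
    inside = trans (lookup-⁅⁆ v v) (dec-true (v ≟ v) refl)
    outside : ∀ w → w ≢ v → (if lookup ⁅ v ⁆ w then deg E w else 0) ≡ 0
    outside w w≢v rewrite lookup-⁅⁆ v w | dec-false (w ≟ v) w≢v = refl

  deg≤vol∁⁅⁆ : ∀ {n} {E : EdgeSet n} → IsSimple E → ∀ v → deg E v ≤ vol E (∁ ⁅ v ⁆)
  deg≤vol∁⁅⁆ {E = E} (E-undirected , E-loopless) v = sumFin-mono neighbour≤
    where
    neighbour≤ : ∀ w → [ E v w ] ≤ (if lookup (∁ ⁅ v ⁆) w then deg E w else 0)
    neighbour≤ w rewrite lookup-∁ ⁅ v ⁆ w | lookup-⁅⁆ v w with w ≟ v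
    ... | yes refl rewrite E-loopless w = z≤n
    ... | no  _    rewrite E-undirected v w = term≤sumFin (λ x → [ E w x ]) v

  numEdges-double≤vol : ∀ {n} {E : EdgeSet n} → Undirected E → numEdges E + numEdges E ≤ vol E ⊤
  numEdges-double≤vol {E = E} E-undirected = begin
    numEdges E + numEdges E
      ≡⟨ cong (numEdges E +_) (sumPairs-transpose (λ u v → [ does (toℕ u <? toℕ v) ∧ E u v ])) ⟩
    sumPairs (λ u v → [ does (toℕ u <? toℕ v) ∧ E u v ])
      + sumPairs (λ u v → [ does (toℕ v <? toℕ u) ∧ E v u ])
      ≡⟨ sumPairs-distrib-+ (λ u v → [ does (toℕ u <? toℕ v) ∧ E u v ]) _ ⟨
    sumPairs (λ u v → [ does (toℕ u <? toℕ v) ∧ E u v ] + [ does (toℕ v <? toℕ u) ∧ E v u ])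
      ≤⟨ sumPairs-mono oriented≤ ⟩
    sumPairs (λ u v → [ E u v ])
      ≡⟨ sumFin-cong (λ u → cong (λ b → if b then deg E u else 0) (lookup-⊤ u)) ⟨
    vol E ⊤ ∎
    where
    open ≤-Reasoning
    oriented≤ : ∀ u v →
      [ does (toℕ u <? toℕ v) ∧ E u v ] + [ does (toℕ v <? toℕ u) ∧ E v u ] ≤ [ E u v ]
    oriented≤ u v rewrite E-undirected v u with toℕ u <ᵇ toℕ v in u<v | toℕ v <ᵇ toℕ u in v<u
    ... | true  | true  =
      ⊥-elim (<-asym (<ᵇ⇒< (toℕ u) _ (subst T (sym u<v) _)) (<ᵇ⇒< (toℕ v) _ (subst T (sym v<u) _)))
    ... | true  | false = ≤-reflexive (+-identityʳ _)
    ... | false | true  = ≤-refl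
    ... | false | false = z≤n

  vol-zero⊎≥ : ∀ {n} (E : EdgeSet n) {δ} → (∀ v → δ ≤ deg E v) → ∀ S →
    vol E S ≡ 0 ⊎ δ ≤ vol E S
  vol-zero⊎≥ E {δ} δ≤deg S = sumFin-zero⊎≥ δ _ term
    where
    term : ∀ u → (if lookup S u then deg E u else 0) ≡ 0 ⊎ δ ≤ (if lookup S u then deg E u else 0)
    term u with lookup S u
    ... | true  = inj₂ (δ≤deg u)
    ... | false = inj₁ refl

  positive-degree : ∀ {n} (E : EdgeSet n) → 0 < vol E ⊤ → ∃ λ v → 0 < deg E v
  positive-degree E 0<vol with sumFin-positive (λ v → if lookup ⊤ v then deg E v else 0) 0<vol
  ... | v , 0<term = v , subst (λ b → 0 < (if b then deg E v else 0)) (lookup-⊤ v) 0<term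

  -- Summed over ordered pairs this is twice |E₀(P, V)| + |E₀[V] ∖ E|: each such edge is seen from both ends.
  potentialTerm : (Vu Vv e₀ e : Bool) → ℕ
  potentialTerm Vu Vv e₀ e = [ not Vu ∧ Vv ∧ e₀ ] + [ Vu ∧ not Vv ∧ e₀ ] + [ Vu ∧ Vv ∧ e₀ ∧ not e ]

  potential : ∀ {n} → EdgeSet n → State n → ℕ
  potential E₀ G = sumPairs λ u v →
    potentialTerm (lookup (verts G) u) (lookup (verts G) v) (E₀ u v) (edges G u v)

  potential-initial : ∀ {n} (E₀ : EdgeSet n) → potential E₀ ⟨ ⊤ , E₀ ⟩ ≡ 0
  potential-initial {n} E₀ =
    trans (sumPairs-cong vanish) (trans (sumFin-cong {n} λ _ → sumFin-zero n) (sumFin-zero n))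
    where
    vanish : ∀ u v → potentialTerm (lookup ⊤ u) (lookup ⊤ v) (E₀ u v) (E₀ u v) ≡ 0
    vanish u v rewrite lookup-⊤ u | lookup-⊤ v with E₀ u v
    ... | true  = refl
    ... | false = refl

  sumPairs-[≟∧≟] : ∀ {n} (a b : Fin n) → sumPairs (λ u v → [ does (u ≟ a) ∧ does (v ≟ b) ]) ≡ 1
  sumPairs-[≟∧≟] {n} a b =
    trans (sumFin-supported _ a other-row) (trans (sumFin-cong row-a) (trans (sumFin-supported _ b other-column) refl-b))
    where
    other-row : ∀ u → u ≢ a → sumFin (λ v → [ does (u ≟ a) ∧ does (v ≟ b) ]) ≡ 0
    other-row u u≢a rewrite dec-false (u ≟ a) u≢a = sumFin-zero n
    row-a : ∀ v → [ does (a ≟ a) ∧ does (v ≟ b) ] ≡ [ does (v ≟ b) ]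
    row-a v rewrite dec-true (a ≟ a) refl = refl
    other-column : ∀ v → v ≢ b → [ does (v ≟ b) ] ≡ 0
    other-column v v≢b rewrite dec-false (v ≟ b) v≢b = refl
    refl-b : [ does (b ≟ b) ] ≡ 1
    refl-b rewrite dec-true (b ≟ b) refl = refl

  deletion-check : BoolFormula 6
  deletion-check Vu Vv e₀ e c₁ c₂ =
    potentialTerm Vu Vv e₀ (if c₁ ∨ c₂ then false else e)
      ≤ᵇ potentialTerm Vu Vv e₀ e + ([ c₁ ] + [ c₂ ])

  potential-deleteEdge : ∀ {n} (E₀ : EdgeSet n) V E a b →
    potential E₀ ⟨ V , deleteEdge a b E ⟩ ≤ potential E₀ ⟨ V , E ⟩ + 2
  potential-deleteEdge {n} E₀ V E a b = begin
    potential E₀ ⟨ V , deleteEdge a b E ⟩                ≤⟨ sumPairs-mono pointwise ⟩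
    sumPairs (λ u v → term u v + (hit u v + hit′ u v))   ≡⟨ sumPairs-distrib-+ term _ ⟩
    potential E₀ ⟨ V , E ⟩ + sumPairs (λ u v → hit u v + hit′ u v)
      ≡⟨ cong (potential E₀ ⟨ V , E ⟩ +_) (sumPairs-distrib-+ hit hit′) ⟩
    potential E₀ ⟨ V , E ⟩ + (sumPairs hit + sumPairs hit′)
      ≡⟨ cong (potential E₀ ⟨ V , E ⟩ +_) (cong₂ _+_ (sumPairs-[≟∧≟] a b) (sumPairs-[≟∧≟] b a)) ⟩
    potential E₀ ⟨ V , E ⟩ + 2                          ∎
    where
    open ≤-Reasoning
    term hit hit′ : Fin n → Fin n → ℕ
    term u v = potentialTerm (lookup V u) (lookup V v) (E₀ u v) (E u v)
    hit  u v = [ does (u ≟ a) ∧ does (v ≟ b) ]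
    hit′ u v = [ does (u ≟ b) ∧ does (v ≟ a) ]
    pointwise : ∀ u v → potentialTerm (lookup V u) (lookup V v) (E₀ u v) (deleteEdge a b E u v)
                          ≤ term u v + (hit u v + hit′ u v)
    pointwise u v = ≤ᵇ⇒≤ _ _ (tautology?-sound 6 deletion-check _ (lookup V u) (lookup V v) (E₀ u v) (E u v)
                                (does (u ≟ a) ∧ does (v ≟ b)) (does (u ≟ b) ∧ does (v ≟ a)))

  -- The A-bit of a vertex is passed as a ∧ v (v its V-bit), which builds in A ⊆ V.
  removal-check : BoolFormula 6
  removal-check Vu Vv Au Av e₀ e =
    potentialTerm (Vu ∧ not (Au ∧ Vu)) (Vv ∧ not (Av ∧ Vv)) e₀ ((Vu ∧ not (Au ∧ Vu)) ∧ (Vv ∧ not (Av ∧ Vv)) ∧ e)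
      ≤ᵇ potentialTerm Vu Vv e₀ e
         + ([ (Au ∧ Vu) ∧ (Vv ∧ not (Av ∧ Vv)) ∧ e ] + [ (Vu ∧ not (Au ∧ Vu)) ∧ (Av ∧ Vv) ∧ e ])

  cut-removal-check : BoolFormula 6
  cut-removal-check Vu Vv Au Av e₀ e =
    [ (Au ∧ Vu) ∧ not (Av ∧ Vv) ∧ e₀ ] + [ not (Au ∧ Vu) ∧ (Av ∧ Vv) ∧ e₀ ]
      ≤ᵇ potentialTerm Vu Vv e₀ e
         + ([ (Au ∧ Vu) ∧ (Vv ∧ not (Av ∧ Vv)) ∧ e ] + [ (Vu ∧ not (Au ∧ Vu)) ∧ (Av ∧ Vv) ∧ e ])

  removal-budget : ∀ {n} (E₀ : EdgeSet n) V A {E} → Undirected E →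
    sumPairs (λ u v → potentialTerm (lookup V u) (lookup V v) (E₀ u v) (E u v)
                      + ([ lookup A u ∧ lookup (V ─ A) v ∧ E u v ] + [ lookup (V ─ A) u ∧ lookup A v ∧ E u v ]))
    ≡ potential E₀ ⟨ V , E ⟩ + (cut E A (V ─ A) + cut E A (V ─ A))
  removal-budget E₀ V A {E} E-undirected =
    trans (sumPairs-distrib-+ (λ u v → potentialTerm (lookup V u) (lookup V v) (E₀ u v) (E u v)) _)
      (cong (potential E₀ ⟨ V , E ⟩ +_)
        (trans (sumPairs-distrib-+ (λ u v → [ lookup A u ∧ lookup (V ─ A) v ∧ E u v ]) _)
               (cong (cut E A (V ─ A) +_) (cut-sym E-undirected (V ─ A) A))))

  potential-removeSet : ∀ {n} (E₀ : EdgeSet n) {V A E} → Undirected E → A ⊆ V →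
    potential E₀ (removeSet A ⟨ V , E ⟩) ≤ potential E₀ ⟨ V , E ⟩ + (cut E A (V ─ A) + cut E A (V ─ A))
  potential-removeSet E₀ {V} {A} {E} E-undirected A⊆V =
    ≤-trans (sumPairs-mono pointwise) (≤-reflexive (removal-budget E₀ V A E-undirected))
    where
    pointwise : ∀ u v →
      potentialTerm (lookup (V ─ A) u) (lookup (V ─ A) v) (E₀ u v) (lookup (V ─ A) u ∧ lookup (V ─ A) v ∧ E u v)
        ≤ potentialTerm (lookup V u) (lookup V v) (E₀ u v) (E u v)
          + ([ lookup A u ∧ lookup (V ─ A) v ∧ E u v ] + [ lookup (V ─ A) u ∧ lookup A v ∧ E u v ])
    pointwise u v rewrite lookup-─ V A u | lookup-─ V A v | ⊆⇒lookup-absorb A⊆V u | ⊆⇒lookup-absorb A⊆V v =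
      ≤ᵇ⇒≤ _ _ (tautology?-sound 6 removal-check _
        (lookup V u) (lookup V v) (lookup A u) (lookup A v) (E₀ u v) (E u v))

  cut-removeSet≤ : ∀ {n} {E₀ : EdgeSet n} {V A E} → Undirected E₀ → Undirected E → A ⊆ V →
    cut E₀ A (∁ A) + cut E₀ A (∁ A) ≤ potential E₀ ⟨ V , E ⟩ + (cut E A (V ─ A) + cut E A (V ─ A))
  cut-removeSet≤ {E₀ = E₀} {V} {A} {E} E₀-undirected E-undirected A⊆V = begin
    cut E₀ A (∁ A) + cut E₀ A (∁ A)
      ≡⟨ cong (cut E₀ A (∁ A) +_) (cut-sym E₀-undirected A (∁ A)) ⟩
    cut E₀ A (∁ A) + cut E₀ (∁ A) A
      ≡⟨ sumPairs-distrib-+ (λ u v → [ lookup A u ∧ lookup (∁ A) v ∧ E₀ u v ]) _ ⟨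
    sumPairs (λ u v → [ lookup A u ∧ lookup (∁ A) v ∧ E₀ u v ] + [ lookup (∁ A) u ∧ lookup A v ∧ E₀ u v ])
      ≤⟨ sumPairs-mono pointwise ⟩
    _ ≡⟨ removal-budget E₀ V A E-undirected ⟩
    potential E₀ ⟨ V , E ⟩ + (cut E A (V ─ A) + cut E A (V ─ A)) ∎
    where
    open ≤-Reasoning
    pointwise : ∀ u v →
      [ lookup A u ∧ lookup (∁ A) v ∧ E₀ u v ] + [ lookup (∁ A) u ∧ lookup A v ∧ E₀ u v ]
        ≤ potentialTerm (lookup V u) (lookup V v) (E₀ u v) (E u v)
          + ([ lookup A u ∧ lookup (V ─ A) v ∧ E u v ] + [ lookup (V ─ A) u ∧ lookup A v ∧ E u v ])
    pointwise u v rewrite lookup-∁ A u | lookup-∁ A v | lookup-─ V A u | lookup-─ V A v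
                        | ⊆⇒lookup-absorb A⊆V u | ⊆⇒lookup-absorb A⊆V v =
      ≤ᵇ⇒≤ _ _ (tautology?-sound 6 cut-removal-check _
        (lookup V u) (lookup V v) (lookup A u) (lookup A v) (E₀ u v) (E u v))

  cut-pruned≤potential : ∀ {n} {E₀ : EdgeSet n} → Undirected E₀ → ∀ G →
    cut E₀ (pruned G) (∁ (pruned G)) + cut E₀ (pruned G) (∁ (pruned G)) ≤ potential E₀ G
  cut-pruned≤potential {E₀ = E₀} E₀-undirected ⟨ V , E ⟩ rewrite ∁-⊤─ V = begin
    cut E₀ (⊤ ─ V) V + cut E₀ (⊤ ─ V) V
      ≡⟨ cong (cut E₀ (⊤ ─ V) V +_) (cut-sym E₀-undirected (⊤ ─ V) V) ⟩
    cut E₀ (⊤ ─ V) V + cut E₀ V (⊤ ─ V)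
      ≡⟨ sumPairs-distrib-+ (λ u v → [ lookup (⊤ ─ V) u ∧ lookup V v ∧ E₀ u v ]) _ ⟨
    sumPairs (λ u v → [ lookup (⊤ ─ V) u ∧ lookup V v ∧ E₀ u v ] + [ lookup V u ∧ lookup (⊤ ─ V) v ∧ E₀ u v ])
      ≤⟨ sumPairs-mono pointwise ⟩
    potential E₀ ⟨ V , E ⟩ ∎
    where
    open ≤-Reasoning
    pointwise : ∀ u v → [ lookup (⊤ ─ V) u ∧ lookup V v ∧ E₀ u v ] + [ lookup V u ∧ lookup (⊤ ─ V) v ∧ E₀ u v ]
                          ≤ potentialTerm (lookup V u) (lookup V v) (E₀ u v) (E u v)
    pointwise u v rewrite lookup-─ ⊤ V u | lookup-─ ⊤ V v | lookup-⊤ u | lookup-⊤ v = m≤m+n _ _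

  PruneLoop-preserves : ∀ {n φ} {E₀ : EdgeSet n} (P : State n → Set) →
    (∀ {G} A → Violating φ E₀ G A → P G → P (removeSet A G)) →
    ∀ {G G′} → PruneLoop φ E₀ G G′ → P G → P G′
  PruneLoop-preserves P preserved (done _)           p = p
  PruneLoop-preserves P preserved (step A viol rest) p = PruneLoop-preserves P preserved rest (preserved A viol p)

  PruneLoop-final : ∀ {n φ} {E₀ : EdgeSet n} {G G′} → PruneLoop φ E₀ G G′ →
    ∀ A → ¬ Violating φ E₀ G′ A
  PruneLoop-final (done final)    = final
  PruneLoop-final (step _ _ rest) = PruneLoop-final rest

  pruned-removeSet : ∀ {n} A (G : State n) → pruned G ⊆ pruned (removeSet A G)
  pruned-removeSet A G = ─-antimonoʳ ⊤ (p─q⊆p (verts G) A)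

  Update-pruned-grows : ∀ {n φ} {E₀ : EdgeSet n} {G G′} → Update φ E₀ G G′ → pruned G ⊆ pruned G′
  Update-pruned-grows {G = G} (_ , _ , _ , loop) =
    PruneLoop-preserves (λ H → pruned G ⊆ pruned H) (λ {H} A _ P⊆ → ⊆-trans P⊆ (pruned-removeSet A H))
      loop (λ x∈ → x∈)

module LinearBounds where

  open import Relation.Binary.PropositionalEquality
  open import Data.Empty using (⊥-elim)
  open import Data.Nat using (ℕ; zero; suc; z≤n; s≤s) renaming (_+_ to _+ℕ_; _≤_ to _≤ℕ_; _<_ to _<ℕ_)
  import Data.Nat.Properties as ℕ
  import Data.Nat.Coprimality as Coprime
  open import Data.Integer as ℤ using (+_)
  import Data.Integer.Properties as ℤ
  open import Data.Rational
    using (ℚ; mkℚ; 0ℚ; 1ℚ; _/_; _+_; _*_; -_; _-_; _≤_; _<_; _<?_; *≤*; *<*; nonNegative; positive)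
  open import Relation.Nullary.Decidable using (toWitness)
  open import Data.Rational.Properties
  open import Data.Rational.Solver using (module +-*-Solver)
  open +-*-Solver

  toℚ≡mkℚ : ∀ k → toℚ k ≡ mkℚ (+ k) 0 (Coprime.sym (Coprime.1-coprimeTo k))
  toℚ≡mkℚ k = ↥p/↧p≡p (mkℚ (+ k) 0 _)

  toℚ-+ : ∀ a b → toℚ (a +ℕ b) ≡ toℚ a + toℚ b
  toℚ-+ a b rewrite toℚ≡mkℚ a | toℚ≡mkℚ b =
    cong (_/ 1) (sym (cong₂ ℤ._+_ (ℤ.*-identityʳ (+ a)) (ℤ.*-identityʳ (+ b))))

  toℚ-mono-≤ : ∀ {a b} → a ≤ℕ b → toℚ a ≤ toℚ b
  toℚ-mono-≤ {a} {b} a≤b rewrite toℚ≡mkℚ a | toℚ≡mkℚ b =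
    *≤* (subst₂ ℤ._≤_ (sym (ℤ.*-identityʳ (+ a))) (sym (ℤ.*-identityʳ (+ b))) (ℤ.+≤+ a≤b))

  toℚ-mono-< : ∀ {a b} → a <ℕ b → toℚ a < toℚ b
  toℚ-mono-< {a} {b} a<b rewrite toℚ≡mkℚ a | toℚ≡mkℚ b =
    *<* (subst₂ ℤ._<_ (sym (ℤ.*-identityʳ (+ a))) (sym (ℤ.*-identityʳ (+ b))) (ℤ.+<+ a<b))

  toℚ-cancel-< : ∀ {a b} → toℚ a < toℚ b → a <ℕ b
  toℚ-cancel-< a<b = ℕ.≰⇒> λ b≤a → <-irrefl refl (<-≤-trans a<b (toℚ-mono-≤ b≤a))

  -- The inequalities below are proved by writing the gap between their sides, as a ring identity,
  -- as a nonnegative combination of the gaps of their hypotheses.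
  gap : ∀ {q r} → q ≤ r → 0ℚ ≤ r - q
  gap {q} {r} q≤r = subst (_≤ r - q) (+-inverseʳ q) (+-monoˡ-≤ (- q) q≤r)

  ≤-by-gap : ∀ {q r} s → r - q ≡ s → 0ℚ ≤ s → q ≤ r
  ≤-by-gap {q} {r} s r-q≡s 0≤s =
    subst₂ _≤_ (+-identityˡ q) (solve 2 (λ q r → r :- q :+ q := r) refl q r)
      (+-monoˡ-≤ q (subst (0ℚ ≤_) (sym r-q≡s) 0≤s))

  <-by-gap : ∀ {q r} s → r - q ≡ s → 0ℚ < s → q < r
  <-by-gap {q} {r} s r-q≡s 0<s =
    subst₂ _<_ (+-identityˡ q) (solve 2 (λ q r → r :- q :+ q := r) refl q r)
      (+-monoˡ-< q (subst (0ℚ <_) (sym r-q≡s) 0<s))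

  0≤+ : ∀ {x y} → 0ℚ ≤ x → 0ℚ ≤ y → 0ℚ ≤ x + y
  0≤+ = +-mono-≤

  0≤* : ∀ {x y} → 0ℚ ≤ x → 0ℚ ≤ y → 0ℚ ≤ x * y
  0≤* {x} {y} 0≤x 0≤y = subst (_≤ x * y) (*-zeroʳ x) (*-monoˡ-≤-nonNeg x {{nonNegative 0≤x}} 0≤y)

  0≤[_/suc_] : ∀ k d → 0ℚ ≤ + k / suc d
  0≤[ k /suc d ] = nonNegative⁻¹ (+ k / suc d) {{normalize-nonNeg k (suc d)}}

  PotentialBound : ℚ → (X t q : ℚ) → Set
  PotentialBound φ X t q = X ≤ + 2 / 1 * (t + φ * (+ 1 / 6) * q)

  PrunedBound : ℚ → (q t : ℚ) → Set
  PrunedBound φ q t = + 5 / 1 * φ * q ≤ + 6 / 1 * t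

  potentialBound-initial : ∀ φ → PotentialBound φ 0ℚ 0ℚ 0ℚ
  potentialBound-initial φ = ≤-reflexive
    (solve 1 (λ φ → con 0ℚ := con (+ 2 / 1) :* (con 0ℚ :+ φ :* con (+ 1 / 6) :* con 0ℚ)) refl φ)

  prunedBound-initial : ∀ φ → PrunedBound φ 0ℚ 0ℚ
  prunedBound-initial φ = ≤-reflexive
    (solve 1 (λ φ → con (+ 5 / 1) :* φ :* con 0ℚ := con (+ 6 / 1) :* con 0ℚ) refl φ)

  potentialBound-deletion : ∀ φ X X′ t q → X′ ≤ X + + 2 / 1 → PotentialBound φ X t q →
    PotentialBound φ X′ (1ℚ + t) q
  potentialBound-deletion φ X X′ t q X′≤ bound = ≤-by-gap _
    (solve 5 (λ φ X X′ t q →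
       con (+ 2 / 1) :* ((con 1ℚ :+ t) :+ φ :* con (+ 1 / 6) :* q) :- X′
       := (X :+ con (+ 2 / 1) :- X′) :+ (con (+ 2 / 1) :* (t :+ φ :* con (+ 1 / 6) :* q) :- X)) refl φ X X′ t q)
    (0≤+ (gap X′≤) (gap bound))

  prunedBound-deletion : ∀ φ q t → PrunedBound φ q t → PrunedBound φ q (1ℚ + t)
  prunedBound-deletion φ q t bound = ≤-by-gap _
    (solve 3 (λ φ q t →
       con (+ 6 / 1) :* (con 1ℚ :+ t) :- con (+ 5 / 1) :* φ :* q
       := con (+ 6 / 1) :+ (con (+ 6 / 1) :* t :- con (+ 5 / 1) :* φ :* q)) refl φ q t)
    (0≤+ 0≤[ 6 /suc 0 ] (gap bound))

  potentialBound-removal : ∀ φ X X′ y t q a → X′ ≤ X + (y + y) → PotentialBound φ X t q →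
    y ≤ φ * (+ 1 / 6) * a → PotentialBound φ X′ t (q + a)
  potentialBound-removal φ X X′ y t q a X′≤ bound y≤ = ≤-by-gap _
    (solve 7 (λ φ X X′ y t q a →
       con (+ 2 / 1) :* (t :+ φ :* con (+ 1 / 6) :* (q :+ a)) :- X′
       := (X :+ (y :+ y) :- X′) :+ ((con (+ 2 / 1) :* (t :+ φ :* con (+ 1 / 6) :* q) :- X)
          :+ con (+ 2 / 1) :* (φ :* con (+ 1 / 6) :* a :- y))) refl φ X X′ y t q a)
    (0≤+ (gap X′≤) (0≤+ (gap bound) (0≤* 0≤[ 2 /suc 0 ] (gap y≤))))

  potentialBound-halve : ∀ φ s C X t q → φ * s ≤ C → C + C ≤ X → PotentialBound φ X t q →
    φ * s ≤ t + φ * (+ 1 / 6) * q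
  potentialBound-halve φ s C X t q φs≤C 2C≤X bound = ≤-by-gap _
    (solve 6 (λ φ s C X t q →
       t :+ φ :* con (+ 1 / 6) :* q :- φ :* s
       := (C :- φ :* s) :+ (con (+ 1 / 2) :* (X :- (C :+ C))
          :+ con (+ 1 / 2) :* (con (+ 2 / 1) :* (t :+ φ :* con (+ 1 / 6) :* q) :- X))) refl φ s C X t q)
    (0≤+ (gap φs≤C) (0≤+ (0≤* 0≤[ 1 /suc 1 ] (gap 2C≤X)) (0≤* 0≤[ 1 /suc 1 ] (gap bound))))

  prunedBound-from-expansion : ∀ φ q t → φ * q ≤ t + φ * (+ 1 / 6) * q → PrunedBound φ q t
  prunedBound-from-expansion φ q t φq≤ = ≤-by-gap _
    (solve 3 (λ φ q t →
       con (+ 6 / 1) :* t :- con (+ 5 / 1) :* φ :* q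
       := con (+ 6 / 1) :* (t :+ φ :* con (+ 1 / 6) :* q :- φ :* q)) refl φ q t)
    (0≤* 0≤[ 6 /suc 0 ] (gap φq≤))

  prunedBound⇒≤3t : ∀ φ q t → 0ℚ ≤ t → PrunedBound φ q t → φ * q ≤ + 3 / 1 * t
  prunedBound⇒≤3t φ q t 0≤t bound = ≤-by-gap _
    (solve 3 (λ φ q t →
       con (+ 3 / 1) :* t :- φ :* q
       := con (+ 1 / 5) :* (con (+ 6 / 1) :* t :- con (+ 5 / 1) :* φ :* q) :+ con (+ 9 / 5) :* t) refl φ q t)
    (0≤+ (0≤* 0≤[ 1 /suc 4 ] (gap bound)) (0≤* 0≤[ 9 /suc 4 ] 0≤t))

  prunedBound-removal⇒≤3t : ∀ φ q a t → 0ℚ ≤ t → φ * a ≤ t + φ * (+ 1 / 6) * (q + a) →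
    PrunedBound φ q t → φ * (q + a) ≤ + 3 / 1 * t
  prunedBound-removal⇒≤3t φ q a t 0≤t φa≤ bound = ≤-by-gap _
    (solve 4 (λ φ q a t →
       con (+ 3 / 1) :* t :- φ :* (q :+ a)
       := con (+ 6 / 5) :* (t :+ φ :* con (+ 1 / 6) :* (q :+ a) :- φ :* a)
          :+ (con (+ 6 / 25) :* (con (+ 6 / 1) :* t :- con (+ 5 / 1) :* φ :* q) :+ con (+ 9 / 25) :* t)) refl φ q a t)
    (0≤+ (0≤* 0≤[ 6 /suc 4 ] (gap φa≤))
         (0≤+ (0≤* 0≤[ 6 /suc 24 ] (gap bound)) (0≤* 0≤[ 9 /suc 24 ] 0≤t)))

  0<* : ∀ {x y} → 0ℚ < x → 0ℚ < y → 0ℚ < x * y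
  0<* {x} {y} 0<x 0<y = subst (_< x * y) (*-zeroʳ x) (*-monoʳ-<-pos x {{positive 0<x}} 0<y)

  early-volume<edges : ∀ φ q m t → 0ℚ < φ → φ ≤ 1ℚ → 0ℚ < m → t ≤ φ * φ * m * (+ 1 / 20) →
    φ * q ≤ + 3 / 1 * t → q < m
  early-volume<edges φ q m t 0<φ φ≤1 0<m early φq≤3t =
    *-cancelˡ-<-nonNeg φ {{nonNegative (<⇒≤ 0<φ)}} (<-by-gap _
      (solve 4 (λ φ q m t →
         φ :* m :- φ :* q
         := (con (+ 3 / 1) :* t :- φ :* q) :+ (con (+ 3 / 1) :* (φ :* φ :* m :* con (+ 1 / 20) :- t)
            :+ (con (+ 3 / 20) :* (φ :* m) :* (con 1ℚ :- φ) :+ con (+ 17 / 20) :* (φ :* m)))) refl φ q m t)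
      (+-mono-≤-< (gap φq≤3t) (+-mono-≤-< (0≤* 0≤[ 3 /suc 0 ] (gap early))
        (+-mono-≤-< (0≤* (0≤* 0≤[ 3 /suc 19 ] (<⇒≤ 0<φm)) (gap φ≤1)) (0<* 0<17/20 0<φm)))))
    where
    0<φm : 0ℚ < φ * m
    0<φm = 0<* 0<φ 0<m
    0<17/20 : 0ℚ < + 17 / 20
    0<17/20 = toWitness {a? = 0ℚ <? + 17 / 20} _

  ≤1-from : ∀ φ d → 0ℚ < d → φ * d ≤ d → φ ≤ 1ℚ
  ≤1-from φ d 0<d φd≤d = *-cancelʳ-≤-pos d {{positive 0<d}} (subst (φ * d ≤_) (sym (*-identityˡ d)) φd≤d)

  early⇒edges-positive : ∀ φ {t} m → 1ℚ ≤ t → t ≤ φ * φ * toℚ m * (+ 1 / 20) → 0 <ℕ m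
  early⇒edges-positive φ zero    1≤t early = ⊥-elim (<-irrefl refl
    (<-≤-trans 0<1 (≤-trans 1≤t (≤-trans early
      (≤-reflexive (solve 1 (λ φ → φ :* φ :* con 0ℚ :* con (+ 1 / 20) := con 0ℚ) refl φ))))))
    where
    0<1 : 0ℚ < 1ℚ
    0<1 = toWitness {a? = 0ℚ <? 1ℚ} _
  early⇒edges-positive _ (suc m) _   _     = s≤s z≤n

module Pruning where

  open import Data.Nat using (ℕ; zero; suc; _+_; _≤_; _<_; _≤?_; z≤n)
  open import Data.Nat.Properties
    using (≤-trans; <⇒≤; ≰⇒>; ≮⇒≥; <-irrefl; +-mono-<; +-monoˡ-<; +-monoˡ-≤; +-identityʳ;
           n≤1+n; <-≤-trans; m≤m+n; m≤n+m; module ≤-Reasoning)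
  open import Data.Rational using (ℚ; 0ℚ; 1ℚ; _/_; _*_; _⊓_; NonNegative; nonNegative)
    renaming (_≤_ to _≤ℚ_; _<_ to _<ℚ_; _+_ to _+ℚ_)
  import Data.Rational.Properties as ℚ
  open import Data.Fin.Subset using (Subset; _∈_; _⊆_; ⊤; ∁; _─_; ⁅_⁆)
  open import Data.Fin.Subset.Properties using (x∈⁅y⁆⇒x≡y; p─q⊆p; p─⊤≡⊥)
  open import Data.Integer using (+_)
  open import Data.Product using (_,_; proj₁)
  open import Data.Sum using (inj₁; inj₂)
  open import Data.Empty using (⊥; ⊥-elim)
  open import Relation.Binary.PropositionalEquality
  open import Relation.Nullary using (¬_; Dec; yes; no)
  open Counting
  open LinearBounds

  no-violation⇒expanding : ∀ {n} φ (E₀ : EdgeSet n) G → 0ℚ ≤ℚ φ → Undirected (edges G) →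
    (∀ A → ¬ Violating φ E₀ G A) → ∀ A → A ⊆ verts G →
    φ * (+ 1 / 6) * (toℚ (vol E₀ A) ⊓ toℚ (vol E₀ (verts G ─ A)))
      ≤ℚ toℚ (cut (edges G) A (verts G ─ A))
  no-violation⇒expanding φ E₀ ⟨ V , E ⟩ 0≤φ E-undirected no-violation A A⊆V =
    by-smaller-side (vol E₀ A ≤? vol E₀ (V ─ A))
    where
    c≥0 : NonNegative (φ * (+ 1 / 6))
    c≥0 = nonNegative (0≤* 0≤φ 0≤[ 1 /suc 5 ])
    by-smaller-side : Dec (vol E₀ A ≤ vol E₀ (V ─ A)) →
      φ * (+ 1 / 6) * (toℚ (vol E₀ A) ⊓ toℚ (vol E₀ (V ─ A))) ≤ℚ toℚ (cut E A (V ─ A))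
    by-smaller-side (yes A-smaller) =
      ℚ.≤-trans (ℚ.*-monoˡ-≤-nonNeg (φ * (+ 1 / 6)) {{c≥0}}
                  (ℚ.p⊓q≤p (toℚ (vol E₀ A)) (toℚ (vol E₀ (V ─ A)))))
                (ℚ.≮⇒≥ λ sparse → no-violation A (A⊆V , A-smaller , sparse))
    by-smaller-side (no A-larger) =
      ℚ.≤-trans (ℚ.*-monoˡ-≤-nonNeg (φ * (+ 1 / 6)) {{c≥0}}
                  (ℚ.p⊓q≤q (toℚ (vol E₀ A)) (toℚ (vol E₀ (V ─ A)))))
                (subst (λ x → φ * (+ 1 / 6) * toℚ (vol E₀ (V ─ A)) ≤ℚ toℚ x) cut-complement
                  (ℚ.≮⇒≥ λ sparse → no-violation (V ─ A) (p─q⊆p V A , complement-smaller , sparse)))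
      where
      complement-smaller : vol E₀ (V ─ A) ≤ vol E₀ (V ─ (V ─ A))
      complement-smaller =
        subst (λ X → vol E₀ (V ─ A) ≤ vol E₀ X) (sym (─-─ A⊆V)) (<⇒≤ (≰⇒> A-larger))
      cut-complement : cut E (V ─ A) (V ─ (V ─ A)) ≡ cut E A (V ─ A)
      cut-complement = trans (cong (cut E (V ─ A)) (─-─ A⊆V)) (cut-sym E-undirected (V ─ A) A)

  module PruneRun {n} (φ : ℚ) (E₀ : EdgeSet n) (m : ℕ) (0<φ : 0ℚ <ℚ φ) (0<m : 0 < m)
                  (E₀-simple : IsSimple E₀) (expander : IsExpander φ E₀) (2m≤vol : m + m ≤ vol E₀ ⊤) where

    E₀-undirected : Undirected E₀
    E₀-undirected = proj₁ E₀-simple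

    Early : ℕ → Set
    Early t = toℚ t ≤ℚ φ * φ * toℚ m * (+ 1 / 20)

    record Invariant (t : ℕ) (G : State n) : Set where
      field
        undirected      : Undirected (edges G)
        potential-bound : PotentialBound φ (toℚ (potential E₀ G)) (toℚ t) (toℚ (vol E₀ (pruned G)))
        pruned-bound    : PrunedBound φ (toℚ (vol E₀ (pruned G))) (toℚ t)
    open Invariant public

    expansion : ∀ S → vol E₀ S ≤ vol E₀ (∁ S) → φ * toℚ (vol E₀ S) ≤ℚ toℚ (cut E₀ S (∁ S))
    expansion S smaller =
      subst (λ x → φ * x ≤ℚ toℚ (cut E₀ S (∁ S))) (ℚ.p≤q⇒p⊓q≡p (toℚ-mono-≤ smaller)) (expander S)

    -- A vertex of positive degree is the smaller side of its own cut, and that cut has at most deg edges.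
    φ≤1 : φ ≤ℚ 1ℚ
    φ≤1 with positive-degree E₀ (≤-trans 0<m (≤-trans (m≤m+n m m) 2m≤vol))
    ... | v , 0<deg = ≤1-from φ (toℚ (vol E₀ ⁅ v ⁆)) (toℚ-mono-< 0<vol)
      (ℚ.≤-trans (expansion ⁅ v ⁆ smaller) (toℚ-mono-≤ (cut≤vol E₀ ⁅ v ⁆ (∁ ⁅ v ⁆))))
      where
      0<vol : 0 < vol E₀ ⁅ v ⁆
      0<vol = subst (0 <_) (sym (vol-⁅⁆ E₀ v)) 0<deg
      smaller : vol E₀ ⁅ v ⁆ ≤ vol E₀ (∁ ⁅ v ⁆)
      smaller = subst (_≤ vol E₀ (∁ ⁅ v ⁆)) (sym (vol-⁅⁆ E₀ v)) (deg≤vol∁⁅⁆ E₀-simple v)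

    volume<m : ∀ {t} q → Early t → φ * toℚ q ≤ℚ + 3 / 1 * toℚ t → q < m
    volume<m {t} q early φq≤3t =
      toℚ-cancel-< (early-volume<edges φ (toℚ q) (toℚ m) (toℚ t) 0<φ φ≤1 (toℚ-mono-< 0<m) early φq≤3t)

    pruned<m : ∀ {t G} → Early t → Invariant t G → vol E₀ (pruned G) < m
    pruned<m {t} {G} early inv = volume<m {t} (vol E₀ (pruned G)) early
      (prunedBound⇒≤3t φ (toℚ (vol E₀ (pruned G))) (toℚ t) (toℚ-mono-≤ {0} {t} z≤n) (pruned-bound inv))

    expansion-bound : ∀ {t q} S Y → vol E₀ S ≤ vol E₀ (∁ S) →
      cut E₀ S (∁ S) + cut E₀ S (∁ S) ≤ Y → PotentialBound φ (toℚ Y) (toℚ t) q →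
      φ * toℚ (vol E₀ S) ≤ℚ toℚ t +ℚ φ * (+ 1 / 6) * q
    expansion-bound {t} {q} S Y smaller 2cut≤Y =
      potentialBound-halve φ (toℚ (vol E₀ S)) (toℚ (cut E₀ S (∁ S))) (toℚ Y) (toℚ t) q
        (expansion S smaller) (subst (_≤ℚ toℚ Y) (toℚ-+ (cut E₀ S (∁ S)) _) (toℚ-mono-≤ 2cut≤Y))

    initial : Invariant 0 ⟨ ⊤ , E₀ ⟩
    initial = record
      { undirected      = E₀-undirected
      ; potential-bound = subst₂ (λ X q → PotentialBound φ (toℚ X) 0ℚ (toℚ q))
                            (sym (potential-initial E₀)) (sym nothing-pruned) (potentialBound-initial φ)
      ; pruned-bound    = subst (λ q → PrunedBound φ (toℚ q) 0ℚ) (sym nothing-pruned) (prunedBound-initial φ)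
      }
      where
      nothing-pruned : vol E₀ (⊤ ─ ⊤) ≡ 0
      nothing-pruned = trans (cong (vol E₀) (p─⊤≡⊥ ⊤)) (vol-⊥ E₀)

    deleteEdge-preserves : ∀ {t V E} a b → Invariant t ⟨ V , E ⟩ →
      Invariant (suc t) ⟨ V , deleteEdge a b E ⟩
    deleteEdge-preserves {t} {V} {E} a b inv = record
      { undirected      = deleteEdge-undirected a b (undirected inv)
      ; potential-bound = subst (λ s → PotentialBound φ X′ s P) (sym (toℚ-+ 1 t))
                            (potentialBound-deletion φ X X′ (toℚ t) P X′≤X+2 (potential-bound inv))
      ; pruned-bound    = subst (PrunedBound φ P) (sym (toℚ-+ 1 t))
                            (prunedBound-deletion φ P (toℚ t) (pruned-bound inv))
      }
      where
      X X′ P : ℚ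
      X  = toℚ (potential E₀ ⟨ V , E ⟩)
      X′ = toℚ (potential E₀ ⟨ V , deleteEdge a b E ⟩)
      P  = toℚ (vol E₀ (⊤ ─ V))
      X′≤X+2 : X′ ≤ℚ X +ℚ + 2 / 1
      X′≤X+2 = subst (X′ ≤ℚ_) (toℚ-+ (potential E₀ ⟨ V , E ⟩) 2)
                 (toℚ-mono-≤ (potential-deleteEdge E₀ V E a b))

    removal-budget-bound : ∀ {t V E} A → Violating φ E₀ ⟨ V , E ⟩ A → Invariant t ⟨ V , E ⟩ →
      PotentialBound φ (toℚ (potential E₀ ⟨ V , E ⟩ + (cut E A (V ─ A) + cut E A (V ─ A))))
                       (toℚ t) (toℚ (vol E₀ (⊤ ─ V) + vol E₀ A))
    removal-budget-bound {t} {V} {E} A (_ , _ , sparse) inv =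
      subst (PotentialBound φ (toℚ (X + (x + x))) (toℚ t)) (sym (toℚ-+ (vol E₀ (⊤ ─ V)) (vol E₀ A)))
        (potentialBound-removal φ (toℚ X) (toℚ (X + (x + x))) (toℚ x) (toℚ t)
          (toℚ (vol E₀ (⊤ ─ V))) (toℚ (vol E₀ A))
          (ℚ.≤-reflexive (trans (toℚ-+ X (x + x)) (cong (toℚ X +ℚ_) (toℚ-+ x x))))
          (potential-bound inv) (ℚ.<⇒≤ sparse))
      where
      X x : ℕ
      X = potential E₀ ⟨ V , E ⟩
      x = cut E A (V ─ A)

    pruned-stays-minority : ∀ {t V E} A → Early t → Violating φ E₀ ⟨ V , E ⟩ A →
      Invariant t ⟨ V , E ⟩ → vol E₀ (⊤ ─ V) + vol E₀ A ≤ vol E₀ (V ─ A)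
    pruned-stays-minority {t} {V} {E} A early violating@(A⊆V , A-smaller , _) inv = ≮⇒≥ not-larger
      where
      p a w : ℕ
      p = vol E₀ (⊤ ─ V)
      a = vol E₀ A
      w = vol E₀ (V ─ A)
      a≤vol∁A : a ≤ vol E₀ (∁ A)
      a≤vol∁A = subst (a ≤_) (sym (vol-∁ E₀ A⊆V)) (≤-trans A-smaller (m≤n+m w p))
      φa≤ : φ * toℚ a ≤ℚ toℚ t +ℚ φ * (+ 1 / 6) * (toℚ p +ℚ toℚ a)
      φa≤ = subst (λ q → φ * toℚ a ≤ℚ toℚ t +ℚ φ * (+ 1 / 6) * q) (toℚ-+ p a)
        (expansion-bound {t} {toℚ (p + a)} A _ a≤vol∁A (cut-removeSet≤ E₀-undirected (undirected inv) A⊆V)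
          (removal-budget-bound A violating inv))
      p+a<m : p + a < m
      p+a<m = volume<m {t} (p + a) early (subst (λ q → φ * q ≤ℚ + 3 / 1 * toℚ t) (sym (toℚ-+ p a))
        (prunedBound-removal⇒≤3t φ (toℚ p) (toℚ a) (toℚ t) (toℚ-mono-≤ {0} {t} z≤n) φa≤
          (pruned-bound inv)))
      not-larger : ¬ (w < p + a)
      not-larger w<p+a = <-irrefl refl (begin-strict
        m + m                         ≤⟨ 2m≤vol ⟩
        vol E₀ ⊤                      ≡⟨ vol-⊤ E₀ (V ─ A) ⟩
        w + vol E₀ (⊤ ─ (V ─ A))      ≡⟨ cong (λ q → w + q) (vol-pruned-removeSet E₀ A⊆V) ⟩
        w + (p + a)                   <⟨ +-monoˡ-< (p + a) w<p+a ⟩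
        (p + a) + (p + a)             <⟨ +-mono-< p+a<m p+a<m ⟩
        m + m                         ∎)
        where open ≤-Reasoning

    removeSet-preserves : ∀ {t} G A → Early t → Violating φ E₀ G A → Invariant t G →
      Invariant t (removeSet A G)
    removeSet-preserves {t} ⟨ V , E ⟩ A early violating@(A⊆V , _ , _) inv = record
      { undirected      = restrict-undirected (V ─ A) (undirected inv)
      ; potential-bound = potential-bound′
      ; pruned-bound    = prunedBound-from-expansion φ (toℚ (vol E₀ P′)) (toℚ t)
          (expansion-bound {t} {toℚ (vol E₀ P′)} P′ (potential E₀ G′) P′-smaller
            (cut-pruned≤potential E₀-undirected G′) potential-bound′)
      }
      where
      G′ : State _
      G′ = removeSet A ⟨ V , E ⟩
      P′ : Subset _
      P′ = pruned G′
      vol-P′ : vol E₀ P′ ≡ vol E₀ (⊤ ─ V) + vol E₀ A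
      vol-P′ = vol-pruned-removeSet E₀ A⊆V
      potential-bound′ : PotentialBound φ (toℚ (potential E₀ G′)) (toℚ t) (toℚ (vol E₀ P′))
      potential-bound′ =
        subst (λ q → PotentialBound φ (toℚ (potential E₀ G′)) (toℚ t) (toℚ q)) (sym vol-P′)
          (ℚ.≤-trans (toℚ-mono-≤ (potential-removeSet E₀ (undirected inv) A⊆V))
                     (removal-budget-bound A violating inv))
      P′-smaller : vol E₀ P′ ≤ vol E₀ (∁ P′)
      P′-smaller = subst₂ (λ q S → q ≤ vol E₀ S) (sym vol-P′) (sym (∁-⊤─ (V ─ A)))
        (pruned-stays-minority A early violating inv)

    run-invariant : ∀ {T G} → IsRun φ E₀ T G → ∀ s → s ≤ T → Early s → Invariant s (G s)
    run-invariant (G₀≡ , _) zero _ _ rewrite G₀≡ = initial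
    run-invariant run@(_ , update) (suc s) s<T early with update s s<T
    ... | a , b , _ , loop =
      PruneLoop-preserves (Invariant (suc s)) (λ A violating → removeSet-preserves _ A early violating) loop
        (deleteEdge-preserves a b (run-invariant run s (≤-trans (n≤1+n s) s<T) earlier))
      where
      earlier : Early s
      earlier = ℚ.≤-trans (toℚ-mono-≤ (n≤1+n s)) early

    -- Otherwise every edge of G₀ has an endpoint in P, so vol₀(P) ≥ m.
    others-nonzero : ∀ {t V E} v → Early t → Invariant t ⟨ V , E ⟩ → v ∈ V →
      vol E₀ (V ─ ⁅ v ⁆) ≡ 0 → ⊥
    others-nonzero {t} {V} {E} v early inv v∈V rest≡0 =
      <-irrefl refl (<-≤-trans (+-mono-< p<m p<m) m+m≤p+p)
      where
      open ≤-Reasoning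
      p : ℕ
      p = vol E₀ (⊤ ─ V)
      p<m : p < m
      p<m = pruned<m {t} {⟨ V , E ⟩} early inv
      ⁅v⁆⊆V : ⁅ v ⁆ ⊆ V
      ⁅v⁆⊆V x∈⁅v⁆ rewrite x∈⁅y⁆⇒x≡y v x∈⁅v⁆ = v∈V
      ⁅v⁆≤p : vol E₀ ⁅ v ⁆ ≤ p
      ⁅v⁆≤p = begin
        vol E₀ ⁅ v ⁆               ≡⟨ vol-⁅⁆ E₀ v ⟩
        deg E₀ v                   ≤⟨ deg≤vol∁⁅⁆ E₀-simple v ⟩
        vol E₀ (∁ ⁅ v ⁆)           ≡⟨ vol-∁ E₀ ⁅v⁆⊆V ⟩
        p + vol E₀ (V ─ ⁅ v ⁆)     ≡⟨ cong (λ r → p + r) rest≡0 ⟩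
        p + 0                      ≡⟨ +-identityʳ p ⟩
        p                          ∎
      m+m≤p+p : m + m ≤ p + p
      m+m≤p+p = begin
        m + m                                ≤⟨ 2m≤vol ⟩
        vol E₀ ⊤                             ≡⟨ vol-⊤ E₀ V ⟩
        vol E₀ V + p                         ≡⟨ cong (_+ p) (vol-split E₀ ⁅v⁆⊆V) ⟩
        vol E₀ ⁅ v ⁆ + vol E₀ (V ─ ⁅ v ⁆) + p ≡⟨ cong (λ r → vol E₀ ⁅ v ⁆ + r + p) rest≡0 ⟩
        vol E₀ ⁅ v ⁆ + 0 + p                 ≡⟨ cong (_+ p) (+-identityʳ _) ⟩
        vol E₀ ⁅ v ⁆ + p                     ≤⟨ +-monoˡ-≤ p ⁅v⁆≤p ⟩
        p + p                                ∎

    degree-bound : ∀ {t δ V E} → (∀ v → δ ≤ deg E₀ v) → Early t → Invariant t ⟨ V , E ⟩ →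
      (∀ A → A ⊆ V →
         φ * (+ 1 / 6) * (toℚ (vol E₀ A) ⊓ toℚ (vol E₀ (V ─ A))) ≤ℚ toℚ (cut E A (V ─ A))) →
      ∀ v → v ∈ V → φ * (+ 1 / 6) * toℚ δ ≤ℚ toℚ (deg E v)
    degree-bound {t} {δ} {V} {E} δ≤deg early inv expanding v v∈V =
      ℚ.≤-trans (ℚ.*-monoˡ-≤-nonNeg (φ * (+ 1 / 6)) {{c≥0}}
                  (ℚ.⊓-glb (toℚ-mono-≤ δ≤vol⁅v⁆) (toℚ-mono-≤ δ≤others)))
        (ℚ.≤-trans (expanding ⁅ v ⁆ ⁅v⁆⊆V)
          (toℚ-mono-≤ (subst (cut E ⁅ v ⁆ (V ─ ⁅ v ⁆) ≤_) (vol-⁅⁆ E v)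
                        (cut≤vol E ⁅ v ⁆ (V ─ ⁅ v ⁆)))))
      where
      c≥0 : NonNegative (φ * (+ 1 / 6))
      c≥0 = nonNegative (0≤* (ℚ.<⇒≤ 0<φ) 0≤[ 1 /suc 5 ])
      ⁅v⁆⊆V : ⁅ v ⁆ ⊆ V
      ⁅v⁆⊆V x∈⁅v⁆ rewrite x∈⁅y⁆⇒x≡y v x∈⁅v⁆ = v∈V
      δ≤vol⁅v⁆ : δ ≤ vol E₀ ⁅ v ⁆
      δ≤vol⁅v⁆ = subst (δ ≤_) (sym (vol-⁅⁆ E₀ v)) (δ≤deg v)
      δ≤others : δ ≤ vol E₀ (V ─ ⁅ v ⁆)
      δ≤others with vol-zero⊎≥ E₀ δ≤deg (V ─ ⁅ v ⁆)
      ... | inj₁ others≡0 = ⊥-elim (others-nonzero v early inv v∈V others≡0)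
      ... | inj₂ δ≤       = δ≤

open import Data.Nat using (ℕ; zero; suc; _≤_)
open import Data.Fin using (Fin)
open import Data.Fin.Subset using (Subset; _⊆_; _∈_; _─_)
open import Data.Integer using (+_)
open import Data.Rational using (ℚ; 0ℚ; _/_; _*_; _⊓_; _<_) renaming (_≤_ to _≤ℚ_)
open import Data.Rational.Properties using (<⇒≤)
open import Data.Product using (_×_; _,_; proj₁; proj₂)
open import Relation.Binary.PropositionalEquality using (_≡_; refl)
open Counting using (numEdges-double≤vol; PruneLoop-final; Update-pruned-grows)
open LinearBounds using (toℚ-mono-≤; early⇒edges-positive)
open Pruning using (no-violation⇒expanding; module PruneRun)

theorem3p5 : ∀ {n : ℕ} (φ : ℚ) (E₀ : EdgeSet n) (m δ : ℕ) →
    0ℚ < φ → IsSimple E₀ → IsExpander φ E₀ →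
    numEdges E₀ ≡ m → IsMinDegree E₀ δ →
    ∀ (T : ℕ) (G : ℕ → State n) → IsRun φ E₀ T G →
    ∀ (t : ℕ) → 1 ≤ t → t ≤ T →
      toℚ t ≤ℚ φ * φ * toℚ m * (+ 1 / 20) →
      -- (i)
      (suc t ≤ T → pruned (G t) ⊆ pruned (G (suc t))) ×
      -- (ii)
      (∀ (A : Subset n) → A ⊆ verts (G t) →
         (φ * (+ 1 / 6)) * (toℚ (vol E₀ A) ⊓ toℚ (vol E₀ (verts (G t) ─ A)))
           ≤ℚ toℚ (cut (edges (G t)) A (verts (G t) ─ A))) ×
      (∀ (v : Fin n) → v ∈ verts (G t) →
         (φ * (+ 1 / 6)) * toℚ δ ≤ℚ toℚ (deg (edges (G t)) v)) ×
      -- (iii)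
      ((+ 5 / 1) * φ * toℚ (vol E₀ (pruned (G t))) ≤ℚ (+ 6 / 1) * toℚ t)
theorem3p5 _ _ _ _ _ _ _ _ _ _ _ _ zero () _ _
theorem3p5 φ E₀ m δ 0<φ E₀-simple expander refl (δ≤deg , _) T G run (suc s) 1≤t t≤T early =
  (λ t<T → Update-pruned-grows (proj₂ run (suc s) t<T)) ,
  expanding ,
  degree-bound δ≤deg early invariant expanding ,
  pruned-bound invariant
  where
  open PruneRun φ E₀ (numEdges E₀) 0<φ (early⇒edges-positive φ (numEdges E₀) (toℚ-mono-≤ 1≤t) early)
                E₀-simple expander (numEdges-double≤vol (proj₁ E₀-simple))
  invariant : Invariant (suc s) (G (suc s))
  invariant = run-invariant run (suc s) t≤T early
  expanding : ∀ A → A ⊆ verts (G (suc s)) →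
    φ * (+ 1 / 6) * (toℚ (vol E₀ A) ⊓ toℚ (vol E₀ (verts (G (suc s)) ─ A)))
      ≤ℚ toℚ (cut (edges (G (suc s))) A (verts (G (suc s)) ─ A))
  expanding = no-violation⇒expanding φ E₀ (G (suc s)) (<⇒≤ 0<φ) (undirected invariant)
                (PruneLoop-final (proj₂ (proj₂ (proj₂ (proj₂ run s t≤T)))))
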